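{- Let $D$ be a critical strongly connected digraph on $n$ vertices, and let $C$ be a chordless directed cycle in $D$ with $V(C) \neq V(D)$. Then $d(v) \leq n - |V(C)| + 2$ for all $v \in V(C)$, and strict inequality $d(v) < n - |V(C)| + 2$ holds for at least two vertices $v \in V(C)$.
   Context: All digraphs are simple: no loops and no multiple edges (two oppositely directed edges between the same pair of vertices are allowed). A digraph is strongly connected if every vertex is reachable by a directed path from every other vertex; it is critical strongly connected if it is strongly connected and for every vertex $v$ the digraph $D-v$ (delete $v$ and all incident edges) is not strongly connected. A directed cycle $C=(v_1,\dots,v_k)$, $k\ge 2$, with edges $(v_i,v_{i+1})$ (indices mod $k$) is chordless if the only edges of $D$ with both endpoints in $V(C)$ are the edges of $C$. For a vertex $v$, $d(v) = |E^+(v)| + |E^-(v)|$, where $E^+(v)=\{u : (v,u)\in E(D)\}$ and $E^-(v)=\{u : (u,v)\in E(D)\}$. -}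

module Defs where

open import Data.Nat using (ℕ; zero; suc; _+_; _≤_)
open import Data.Nat.DivMod using (_mod_)
open import Data.Fin using (Fin; toℕ)
open import Data.Bool using (Bool; true; false; if_then_else_)
open import Data.List using (List; map; allFin)
open import Data.Nat.ListAction using (sum)
open import Data.Product using (_×_; Σ; ∃)
open import Relation.Binary.PropositionalEquality using (_≡_; _≢_)
open import Relation.Nullary using (¬_)
open import Function.Definitions using (Injective)

-- Multiple edges are impossible by construction; antiparallel pairs allowed.
record Digraph (n : ℕ) : Set where
  field
    adj      : Fin n → Fin n → Bool
    loopless : ∀ v → adj v v ≡ false

open Digraph public

Edge : ∀ {n} → Digraph n → Fin n → Fin n → Set
Edge D u v = adj D u v ≡ true

data PathIn {n} (D : Digraph n) (P : Fin n → Set) : Fin n → Fin n → Set where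
  here : ∀ {u} → P u → PathIn D P u u
  step : ∀ {u w v} → P u → Edge D u w → PathIn D P w v → PathIn D P u v

StronglyConnected : ∀ {n} → Digraph n → Set
StronglyConnected {n} D = ∀ (u v : Fin n) → PathIn D (λ _ → Fin n) u v

DeleteStronglyConnected : ∀ {n} → Digraph n → Fin n → Set
DeleteStronglyConnected {n} D w =
  ∀ (u v : Fin n) → u ≢ w → v ≢ w → PathIn D (λ x → x ≢ w) u v

CriticalStronglyConnected : ∀ {n} → Digraph n → Set
CriticalStronglyConnected D =
  StronglyConnected D × (∀ w → ¬ DeleteStronglyConnected D w)

next : ∀ {m} → Fin (suc m) → Fin (suc m)
next {m} i = suc (toℕ i) mod suc m

record ChordlessCycle {n} (D : Digraph n) (m : ℕ) (c : Fin (suc m) → Fin n) : Set where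
  field
    length≥2  : 1 ≤ m
    injective : Injective _≡_ _≡_ c
    edges     : ∀ i → Edge D (c i) (c (next i))
    chordless : ∀ i j → Edge D (c i) (c j) → j ≡ next i

b2n : Bool → ℕ
b2n true  = 1
b2n false = 0

outdeg indeg deg : ∀ {n} → Digraph n → Fin n → ℕ
outdeg {n} D v = sum (map (λ u → b2n (adj D v u)) (allFin n))
indeg  {n} D v = sum (map (λ u → b2n (adj D u v)) (allFin n))
deg D v = outdeg D v + indeg D v

-- Contracting the vertex set of C into the single vertex c i gives a strongly connected digraph
-- in which every vertex other than c i is still critical, since a walk through the contracted
-- vertex expands to a walk through C. In such a digraph a vertex v is joined to the other
-- vertices by at most |V(D)| - 1 edges: by induction on |V(D)|, contract a digon v ↔ u; as D - u
-- is not strongly connected, u has an edge that v lacks, so the contraction raises the count at v.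
-- Contraction only adds edges at c i, and as C is chordless c i has at most two edges inside C,
-- hence d(c i) ≤ (n - |C|) + 2.
--
-- Equality at c i forces every edge between C and an outside vertex to be present at c i. If it
-- held at both c i and c (i + 2), every walk through c (i + 1) could be rerouted through c i,
-- c (i + 2) and the outside of C, making D - c (i + 1) strongly connected. So of any c i and
-- c (i + 2) one is strict, and applying this to a strict vertex and its predecessor on C gives a
-- second one.

module Submission where

open import Data.Bool using (Bool; true; false; not; _∧_; _∨_; if_then_else_)
import Data.Bool.Properties as Bool
open import Data.Empty using (⊥-elim)
open import Data.Fin using (Fin; zero; suc; toℕ; fromℕ; inject₁)
open import Data.Fin.Properties
  using (_≟_; any?; toℕ-injective; toℕ-fromℕ<; toℕ-fromℕ; toℕ-inject₁; toℕ<n)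
import Data.Fin.Properties as Fin
open import Data.List using (map; tabulate; allFin)
open import Data.List.Properties using (map-tabulate)
open import Data.Nat using (ℕ; zero; suc; _+_; _∸_; _≤_; _<_; z≤n; s≤s; s≤s⁻¹; _%_)
open import Data.Nat.DivMod using (m<n⇒m%n≡m; n%n≡0)
import Data.Nat.ListAction as List
open import Data.Nat.Properties
  using ( _<?_; +-0-commutativeMonoid; module ≤-Reasoning
        ; ≤-refl; ≤-trans; <-≤-trans; <-irrefl; <⇒≱; <⇒≢; ≮⇒≥; ≤∧≮⇒≡; m≤n⇒m<n∨m≡n
        ; suc-injective; 0≢1+n; 1+n≢n; +-comm; +-suc; +-identityʳ; +-cancelˡ-≡; +-cancelʳ-≤
        ; +-mono-≤; +-monoˡ-≤; +-monoʳ-≤; +-mono-<-≤; +-mono-≤-<; m≤n+m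
        ; m+n∸m≡n; m∸n+n≡m; ∸-monoʳ-≤ )
open import Algebra.Properties.CommutativeMonoid.Sum +-0-commutativeMonoid
  using (sum; sum-cong-≗; sum-replicate-zero; ∑-distrib-+)
open import Data.Product using (_×_; _,_; proj₁; proj₂; ∃; ∃₂; ∃-syntax)
open import Data.Sum using (_⊎_; inj₁; inj₂; [_,_]′)
open import Function using (_∘_; id)
open import Function.Definitions using (Injective)
open import Relation.Binary.PropositionalEquality
  using (_≡_; _≢_; refl; sym; trans; cong; cong₂; subst; subst₂; module ≡-Reasoning)
open import Relation.Nullary using (¬_; Dec; yes; no; does; ¬?; _×-dec_)
open import Relation.Nullary.Decidable using (dec-true; dec-false)

open import Defs

b2n≤1 : ∀ b → b2n b ≤ 1
b2n≤1 true  = ≤-refl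
b2n≤1 false = z≤n

b2n-mono : ∀ {b c} → (b ≡ true → c ≡ true) → b2n b ≤ b2n c
b2n-mono {false} _ = z≤n
b2n-mono {true}  b⇒c rewrite b⇒c refl = ≤-refl

b2n-injective : ∀ {b c} → b2n b ≡ b2n c → b ≡ c
b2n-injective {true}  {true}  _ = refl
b2n-injective {false} {false} _ = refl

+-≤-≡ : ∀ {a b c d} → a ≤ c → b ≤ d → a + b ≡ c + d → a ≡ c × b ≡ d
+-≤-≡ {a} {b} {c} {d} a≤c b≤d sum≡ = a≡c , +-cancelˡ-≡ a b d (trans sum≡ (cong (_+ d) (sym a≡c)))
  where
  a≡c : a ≡ c
  a≡c = ≤∧≮⇒≡ a≤c λ a<c → <-irrefl sum≡ (+-mono-<-≤ a<c b≤d)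

witness : ∀ {A : Set} (a? : Dec A) → does a? ≡ true → A
witness (yes a) _ = a

_==_ : ∀ {n} → Fin n → Fin n → Bool
x == y = does (x ≟ y)

==-refl : ∀ {n} (x : Fin n) → (x == x) ≡ true
==-refl x = dec-true (x ≟ x) refl

VertexSet : ℕ → Set
VertexSet n = Fin n → Bool

module _ {n : ℕ} where

  infix 4 _∈_ _∉_ _⊆_ _∈?_
  infixl 6 _─_ _∖_

  record _∈_ (x : Fin n) (A : VertexSet n) : Set where
    constructor member
    field isTrue : A x ≡ true

  open _∈_ public

  _∉_ : Fin n → VertexSet n → Set
  x ∉ A = ¬ x ∈ A

  _∈?_ : ∀ x A → Dec (x ∈ A)
  x ∈? A with A x in eq
  ... | true  = yes (member eq)
  ... | false = no λ x∈A → Bool.not-¬ eq (isTrue x∈A)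

  ∉⇒≡false : ∀ {x A} → x ∉ A → A x ≡ false
  ∉⇒≡false {x} {A} x∉A with A x in eq
  ... | true  = ⊥-elim (x∉A (member eq))
  ... | false = refl

  _⊆_ : VertexSet n → VertexSet n → Set
  A ⊆ B = ∀ {x} → x ∈ A → x ∈ B

  all : VertexSet n
  all _ = true

  _─_ : VertexSet n → Fin n → VertexSet n
  (A ─ w) x = not (x == w) ∧ A x

  _∖_ : VertexSet n → VertexSet n → VertexSet n
  (A ∖ B) x = A x ∧ not (B x)

  ∈-─⁺ : ∀ {A w x} → x ∈ A → x ≢ w → x ∈ A ─ w
  ∈-─⁺ {w = w} {x} (member x∈A) x≢w = member (cong₂ _∧_ (cong not (dec-false (x ≟ w) x≢w)) x∈A)

  ─⊆ : ∀ {A w} → A ─ w ⊆ A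
  ─⊆ {w = w} {x} (member x∈A─w) = member (Bool.∧-conicalʳ (not (x == w)) _ x∈A─w)

  ∈─⇒≢ : ∀ {A w x} → x ∈ A ─ w → x ≢ w
  ∈─⇒≢ {x = x} (member x∈A─w) refl rewrite ==-refl x = Bool.not-¬ refl x∈A─w

  ∈-∖⁺ : ∀ {A B x} → x ∈ A → x ∉ B → x ∈ A ∖ B
  ∈-∖⁺ {B = B} (member x∈A) x∉B = member (cong₂ _∧_ x∈A (cong not (∉⇒≡false {A = B} x∉B)))

  ∖⊆ : ∀ {A B} → A ∖ B ⊆ A
  ∖⊆ {A} {x = x} (member x∈A∖B) = member (Bool.∧-conicalˡ (A x) _ x∈A∖B)

  ∈∖⇒∉ : ∀ {A B x} → x ∈ A ∖ B → x ∉ B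
  ∈∖⇒∉ {A} {x = x} (member x∈A∖B) (member x∈B) rewrite x∈B = Bool.not-¬ (Bool.∧-zeroʳ (A x)) x∈A∖B

image : ∀ {k n} → (Fin k → Fin n) → VertexSet n
image f x = does (any? λ j → f j ≟ x)

module _ {k n} {f : Fin k → Fin n} where

  f∈image : ∀ j → f j ∈ image f
  f∈image j = member (dec-true (any? λ i → f i ≟ f j) (j , refl))

  ∈image⁻ : ∀ {x} → x ∈ image f → ∃ λ j → f j ≡ x
  ∈image⁻ {x} (member x∈) = witness (any? λ j → f j ≟ x) x∈

⁅_,_⁆ : ∀ {n} → Fin n → Fin n → VertexSet n
⁅ u , v ⁆ x = x == u ∨ x == v

module _ {n} {u v : Fin n} where

  u∈⁅u,v⁆ : u ∈ ⁅ u , v ⁆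
  u∈⁅u,v⁆ = member (cong (_∨ (u == v)) (==-refl u))

  v∈⁅u,v⁆ : v ∈ ⁅ u , v ⁆
  v∈⁅u,v⁆ = member (trans (cong ((v == u) ∨_) (==-refl v)) (Bool.∨-zeroʳ (v == u)))

  ∈⁅u,v⁆⁻ : ∀ {x} → x ∈ ⁅ u , v ⁆ → x ≡ u ⊎ x ≡ v
  ∈⁅u,v⁆⁻ {x} (member x∈) with x ≟ u
  ... | yes x≡u = inj₁ x≡u
  ... | no  _   = inj₂ (witness (x ≟ v) x∈)

sum-mono : ∀ {n} {f g : Fin n → ℕ} → (∀ x → f x ≤ g x) → sum f ≤ sum g
sum-mono {zero}  f≤g = z≤n
sum-mono {suc n} f≤g = +-mono-≤ (f≤g zero) (sum-mono (f≤g ∘ suc))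

sum-mono-< : ∀ {n} {f g : Fin n → ℕ} → (∀ x → f x ≤ g x) → ∀ z → f z < g z → sum f < sum g
sum-mono-< {suc n} f≤g zero    fz<gz = +-mono-<-≤ fz<gz (sum-mono (f≤g ∘ suc))
sum-mono-< {suc n} f≤g (suc z) fz<gz = +-mono-≤-< (f≤g zero) (sum-mono-< (f≤g ∘ suc) z fz<gz)

sum-indicator : ∀ {n} (f : Fin n → ℕ) u → sum (λ x → if x == u then f x else 0) ≡ f u
sum-indicator {suc n} f zero    = begin
  f zero + sum {n} (λ _ → 0) ≡⟨ cong (f zero +_) (sum-replicate-zero n) ⟩
  f zero + 0                 ≡⟨ +-identityʳ (f zero) ⟩
  f zero                     ∎
  where open ≡-Reasoning
sum-indicator {suc n} f (suc u) = sum-indicator (f ∘ suc) u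

sumOver : ∀ {n} → VertexSet n → (Fin n → ℕ) → ℕ
sumOver A f = sum λ x → if A x then f x else 0

size : ∀ {n} → VertexSet n → ℕ
size A = sumOver A λ _ → 1

if-mono : ∀ b {k l} → (b ≡ true → k ≤ l) → (if b then k else 0) ≤ (if b then l else 0)
if-mono true  k≤l = k≤l refl
if-mono false _   = z≤n

module _ {n : ℕ} where

  sumOver-cong : ∀ {A B : VertexSet n} {f} → A ⊆ B → B ⊆ A → sumOver A f ≡ sumOver B f
  sumOver-cong {A} {B} {f} A⊆B B⊆A = sum-cong-≗ λ x → cong (λ b → if b then f x else 0) (same x)
    where
    same : ∀ x → A x ≡ B x
    same x with A x in x∈A | B x in x∈B
    ... | true  | true  = refl
    ... | false | false = refl
    ... | true  | false = sym (trans (sym x∈B) (isTrue (A⊆B (member x∈A))))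
    ... | false | true  = trans (sym x∈A) (isTrue (B⊆A (member x∈B)))

  sumOver-mono : ∀ {A : VertexSet n} {f g} → (∀ {x} → x ∈ A → f x ≤ g x) → sumOver A f ≤ sumOver A g
  sumOver-mono {A} f≤g = sum-mono λ x → if-mono (A x) (f≤g ∘ member)

  sumOver-mono-< : ∀ {A : VertexSet n} {f g} → (∀ {x} → x ∈ A → f x ≤ g x) →
                   ∀ {z} → z ∈ A → f z < g z → sumOver A f < sumOver A g
  sumOver-mono-< {A} f≤g {z} z∈A fz<gz =
    sum-mono-< (λ x → if-mono (A x) (f≤g ∘ member)) z
      (subst (λ b → (if b then _ else 0) < (if b then _ else 0)) (sym (isTrue z∈A)) fz<gz)

  sumOver-mono-≡ : ∀ {A : VertexSet n} {f g} → (∀ {x} → x ∈ A → f x ≤ g x) →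
                   sumOver A g ≤ sumOver A f → ∀ {x} → x ∈ A → f x ≡ g x
  sumOver-mono-≡ f≤g g≤f x∈A with m≤n⇒m<n∨m≡n (f≤g x∈A)
  ... | inj₁ fx<gx = ⊥-elim (<⇒≱ (sumOver-mono-< f≤g x∈A fx<gx) g≤f)
  ... | inj₂ fx≡gx = fx≡gx

  sumOver-─ : ∀ (A : VertexSet n) f {u} → u ∈ A → sumOver A f ≡ f u + sumOver (A ─ u) f
  sumOver-─ A f {u} u∈A = begin
    sumOver A f                                          ≡⟨ sum-cong-≗ split ⟩
    sum (λ x → at-u x + (if (A ─ u) x then f x else 0))  ≡⟨ ∑-distrib-+ at-u _ ⟩
    sum at-u + sumOver (A ─ u) f                         ≡⟨ cong (_+ sumOver (A ─ u) f) (sum-indicator f u) ⟩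
    f u + sumOver (A ─ u) f                              ∎
    where
    open ≡-Reasoning
    at-u : Fin n → ℕ
    at-u x = if x == u then f x else 0
    split : ∀ x → (if A x then f x else 0) ≡ at-u x + (if (A ─ u) x then f x else 0)
    split x with x ≟ u
    ... | yes refl rewrite isTrue u∈A = sym (+-identityʳ (f x))
    ... | no _     = refl

  sumOver-complement : ∀ (A : VertexSet n) f → sumOver A f + sumOver (all ∖ A) f ≡ sum f
  sumOver-complement A f = trans (sym (∑-distrib-+ (λ x → if A x then f x else 0) _)) (sum-cong-≗ split)
    where
    split : ∀ x → (if A x then f x else 0) + (if not (A x) then f x else 0) ≡ f x
    split x with A x
    ... | true  = +-identityʳ (f x)
    ... | false = refl

  sumOver-+ : ∀ (A : VertexSet n) f g → sumOver A (λ x → f x + g x) ≡ sumOver A f + sumOver A g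
  sumOver-+ A f g = trans (sum-cong-≗ split) (∑-distrib-+ (λ x → if A x then f x else 0) _)
    where
    split : ∀ x → (if A x then f x + g x else 0) ≡ (if A x then f x else 0) + (if A x then g x else 0)
    split x with A x
    ... | true  = refl
    ... | false = refl

  sumOver-b2n≤1 : ∀ {A B : VertexSet n} {w} → (∀ {x} → x ∈ A → x ∈ B → x ≡ w) → sumOver A (b2n ∘ B) ≤ 1
  sumOver-b2n≤1 {A} {B} {w} only-w = begin
    sumOver A (b2n ∘ B)                          ≤⟨ sum-mono pointwise ⟩
    sum (λ x → if x == w then b2n (B x) else 0)  ≡⟨ sum-indicator (b2n ∘ B) w ⟩
    b2n (B w)                                    ≤⟨ b2n≤1 (B w) ⟩
    1                                            ∎
    where
    open ≤-Reasoning
    pointwise : ∀ x → (if A x then b2n (B x) else 0) ≤ (if x == w then b2n (B x) else 0)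
    pointwise x with x ≟ w | A x in x∈A | B x in x∈B
    ... | yes _   | true  | _     = ≤-refl
    ... | _       | false | _     = z≤n
    ... | no  _   | true  | false = ≤-refl
    ... | no  x≢w | true  | true  = ⊥-elim (x≢w (only-w (member x∈A) (member x∈B)))

  size-mono : ∀ {A B : VertexSet n} → A ⊆ B → size A ≤ size B
  size-mono {A} {B} A⊆B = sum-mono pointwise
    where
    pointwise : ∀ x → (if A x then 1 else 0) ≤ (if B x then 1 else 0)
    pointwise x with A x in x∈A
    ... | true rewrite isTrue (A⊆B (member x∈A)) = ≤-refl
    ... | false = z≤n

size-all : ∀ n → size (all {n}) ≡ n
size-all zero    = refl
size-all (suc n) = cong suc (size-all n)

size-image : ∀ {k n} (f : Fin k → Fin n) → Injective _≡_ _≡_ f → k ≤ size (image f)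
size-image {zero}  f _         = z≤n
size-image {suc k} f injective = begin
  suc k                              ≤⟨ s≤s (size-image (f ∘ suc) (Fin.suc-injective ∘ injective)) ⟩
  suc (size (image (f ∘ suc)))       ≤⟨ s≤s (size-mono image-tail⊆) ⟩
  suc (size (image f ─ f zero))      ≡⟨ sumOver-─ (image f) _ (f∈image {f = f} zero) ⟨
  size (image f)                     ∎
  where
  open ≤-Reasoning
  image-tail⊆ : image (f ∘ suc) ⊆ image f ─ f zero
  image-tail⊆ x∈ with ∈image⁻ {f = f ∘ suc} x∈
  ... | j , refl = ∈-─⁺ (f∈image {f = f} (suc j)) λ same → Fin.0≢1+n (injective (sym same))

module _ {n : ℕ} {D : Digraph n} where

  infixr 5 _++_

  _++_ : ∀ {P : Fin n → Set} {x y z} → PathIn D P x y → PathIn D P y z → PathIn D P x z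
  here _       ++ q = q
  step p e r   ++ q = step p e (r ++ q)

  PathIn-head : ∀ {P : Fin n → Set} {x y} → PathIn D P x y → P x
  PathIn-head (here p)     = p
  PathIn-head (step p _ _) = p

  PathIn-last : ∀ {P : Fin n → Set} {x y} → PathIn D P x y → P y
  PathIn-last (here p)     = p
  PathIn-last (step _ _ r) = PathIn-last r

  PathIn-map : ∀ {P Q : Fin n → Set} → (∀ {z} → P z → Q z) → ∀ {x y} → PathIn D P x y → PathIn D Q x y
  PathIn-map P⇒Q (here p)     = here (P⇒Q p)
  PathIn-map P⇒Q (step p e r) = step (P⇒Q p) e (PathIn-map P⇒Q r)

  leaving-edge : ∀ {P : Fin n → Set} {B : VertexSet n} {x y} → PathIn D P x y → x ∈ B → y ∉ B →
                 ∃₂ λ p s → p ∈ B × s ∉ B × Edge D p s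
  leaving-edge (here _) x∈B y∉B = ⊥-elim (y∉B x∈B)
  leaving-edge {B = B} (step {w = z} _ e r) x∈B y∉B with z ∈? B
  ... | yes z∈B = leaving-edge r z∈B y∉B
  ... | no  z∉B = _ , z , x∈B , z∉B , e

  entering-edge : ∀ {P : Fin n → Set} {B : VertexSet n} {s y} → PathIn D P s y → s ∉ B → y ∈ B →
                  ∃₂ λ t p → PathIn D (_∉ B) s t × p ∈ B × Edge D t p
  entering-edge (here _) s∉B y∈B = ⊥-elim (s∉B y∈B)
  entering-edge {B = B} (step {w = z} _ e r) s∉B y∈B with z ∈? B
  ... | yes z∈B = _ , z , here s∉B , z∈B , e
  ... | no  z∉B with entering-edge r z∉B y∈B
  ...   | t , p , walk , p∈B , e′ = t , p , step s∉B e walk , p∈B , e′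

  edge⇒≢ : ∀ {x y} → Edge D x y → x ≢ y
  edge⇒≢ {x} e refl = Bool.not-¬ (loopless D x) e

Walk : ∀ {n} → Digraph n → VertexSet n → Fin n → Fin n → Set
Walk D A = PathIn D (_∈ A)

StronglyConnectedIn : ∀ {n} → Digraph n → VertexSet n → Set
StronglyConnectedIn {n} D A = ∀ (x y : Fin n) → x ∈ A → y ∈ A → Walk D A x y

CriticalExcept : ∀ {n} → Digraph n → VertexSet n → Fin n → Set
CriticalExcept D A v = ∀ x → x ∈ A → x ≢ v → ¬ StronglyConnectedIn D (A ─ x)

module _ {n : ℕ} {D : Digraph n} where

  edge : ∀ {A : VertexSet n} {x y} → x ∈ A → y ∈ A → Edge D x y → Walk D A x y
  edge x∈A y∈A e = step x∈A e (here y∈A)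

  module _ {A : VertexSet n} {w : Fin n}
           (detour : ∀ {x y} → x ∈ A ─ w → y ∈ A ─ w → Edge D x w → Edge D w y → Walk D (A ─ w) x y) where

    reroute : ∀ {x y} → Walk D A x y → x ≢ w → y ≢ w → Walk D (A ─ w) x y
    rerouteVia : ∀ {x y} → x ∈ A ─ w → Edge D x w → Walk D A w y → y ≢ w → Walk D (A ─ w) x y

    reroute (here x∈A) x≢w _ = here (∈-─⁺ x∈A x≢w)
    reroute (step {w = z} x∈A e r) x≢w y≢w with z ≟ w
    ... | no z≢w   = step (∈-─⁺ x∈A x≢w) e (reroute r z≢w y≢w)
    ... | yes refl = rerouteVia (∈-─⁺ x∈A x≢w) e r y≢w

    rerouteVia _ _ (here _) y≢w = ⊥-elim (y≢w refl)
    rerouteVia x∈A─w e (step {w = z} _ e′ r) y≢w =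
      detour x∈A─w (∈-─⁺ (PathIn-head r) z≢w) e e′ ++ reroute r z≢w y≢w
      where
      z≢w : z ≢ w
      z≢w z≡w = edge⇒≢ {D = D} e′ (sym z≡w)

    bypass : StronglyConnectedIn D A → StronglyConnectedIn D (A ─ w)
    bypass sc x y x∈A─w y∈A─w = reroute (sc x y (─⊆ x∈A─w) (─⊆ y∈A─w)) (∈─⇒≢ x∈A─w) (∈─⇒≢ y∈A─w)

stronglyConnectedIn-all : ∀ {n} {D : Digraph n} → StronglyConnected D → StronglyConnectedIn D all
stronglyConnectedIn-all sc x y _ _ = PathIn-map (λ _ → member refl) (sc x y)

deleteStronglyConnected⁺ : ∀ {n} {D : Digraph n} {w} →
  StronglyConnectedIn D (all ─ w) → DeleteStronglyConnected D w
deleteStronglyConnected⁺ sc x y x≢w y≢w =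
  PathIn-map (∈─⇒≢ {A = all}) (sc x y (∈-─⁺ (member refl) x≢w) (∈-─⁺ (member refl) y≢w))

links : ∀ {n} → Digraph n → Fin n → Fin n → ℕ
links D v x = b2n (adj D v x) + b2n (adj D x v)

degreeIn : ∀ {n} → Digraph n → VertexSet n → Fin n → ℕ
degreeIn D A v = sumOver A (links D v)

sum-allFin : ∀ {n} (f : Fin n → ℕ) → List.sum (map f (allFin n)) ≡ sum f
sum-allFin {n} f = trans (cong List.sum (map-tabulate id f)) (sum-tabulate f)
  where
  sum-tabulate : ∀ {k} (g : Fin k → ℕ) → List.sum (tabulate g) ≡ sum g
  sum-tabulate {zero}  g = refl
  sum-tabulate {suc k} g = cong (g zero +_) (sum-tabulate (g ∘ suc))

deg≡sum-links : ∀ {n} (D : Digraph n) v → deg D v ≡ sum (links D v)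
deg≡sum-links D v = trans (cong₂ _+_ (sum-allFin (b2n ∘ adj D v)) (sum-allFin λ x → b2n (adj D x v)))
                          (sym (∑-distrib-+ (b2n ∘ adj D v) _))

Digon : ∀ {n} → Digraph n → Fin n → Fin n → Set
Digon D v u = Edge D v u × Edge D u v

links≤1 : ∀ {n} (D : Digraph n) {v x} → ¬ Digon D v x → links D v x ≤ 1
links≤1 D {v} {x} no-digon with adj D v x | adj D x v
... | true  | true  = ⊥-elim (no-digon (refl , refl))
... | true  | false = ≤-refl
... | false | b     = b2n≤1 b

links≤2 : ∀ {n} (D : Digraph n) v x → links D v x ≤ 2
links≤2 D v x = +-mono-≤ (b2n≤1 (adj D v x)) (b2n≤1 (adj D x v))

degreeIn≤size-of-digonFree : ∀ {n} (D : Digraph n) {A v} → (∀ {x} → x ∈ A → ¬ Digon D v x) →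
                             degreeIn D A v ≤ size A
degreeIn≤size-of-digonFree D no-digon = sumOver-mono λ x∈A → links≤1 D (no-digon x∈A)

-- Contracting a strongly connected set into one of its vertices

module Contraction {n} (D : Digraph n) (A M : VertexSet n) (M⊆A : M ⊆ A) {v} (v∈M : v ∈ M) where

  rep : Fin n → Fin n
  rep x = if M x then v else x

  rep-∈ : ∀ {x} → x ∈ M → rep x ≡ v
  rep-∈ x∈M rewrite isTrue x∈M = refl

  rep-∉ : ∀ {x} → x ∉ M → rep x ≡ x
  rep-∉ x∉M rewrite ∉⇒≡false {A = M} x∉M = refl

  ContractedEdge : Fin n → Fin n → Set
  ContractedEdge s t = s ≢ t × ∃₂ λ p q → rep p ≡ s × rep q ≡ t × Edge D p q

  contractedEdge? : ∀ s t → Dec (ContractedEdge s t)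
  contractedEdge? s t =
    ¬? (s ≟ t) ×-dec any? λ p → any? λ q → rep p ≟ s ×-dec rep q ≟ t ×-dec adj D p q Bool.≟ true

  D/M : Digraph n
  D/M = record
    { adj      = λ s t → does (contractedEdge? s t)
    ; loopless = λ s → dec-false (contractedEdge? s s) λ (s≢s , _) → s≢s refl
    }

  A/M : VertexSet n
  A/M x = A x ∧ (rep x == x)

  contracted-edge : ∀ {p q} → rep p ≢ rep q → Edge D p q → Edge D/M (rep p) (rep q)
  contracted-edge {p} {q} differ e = dec-true (contractedEdge? _ _) (differ , p , q , refl , refl , e)

  contracted-edge⁻ : ∀ {s t} → Edge D/M s t → ContractedEdge s t
  contracted-edge⁻ = witness (contractedEdge? _ _)

  ∈A/M⁺ : ∀ {x} → x ∈ A → rep x ≡ x → x ∈ A/M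
  ∈A/M⁺ {x} x∈A fixed = member (cong₂ _∧_ (isTrue x∈A) (dec-true (rep x ≟ x) fixed))

  A/M⊆A : A/M ⊆ A
  A/M⊆A {x} (member x∈A/M) = member (Bool.∧-conicalˡ (A x) _ x∈A/M)

  ∈A/M⇒fixed : ∀ {x} → x ∈ A/M → rep x ≡ x
  ∈A/M⇒fixed {x} (member x∈A/M) = witness (rep x ≟ x) (Bool.∧-conicalʳ (A x) _ x∈A/M)

  v∈A/M : v ∈ A/M
  v∈A/M = ∈A/M⁺ (M⊆A v∈M) (rep-∈ v∈M)

  rep∈A/M : ∀ {p} → p ∈ A → rep p ∈ A/M
  rep∈A/M {p} p∈A with p ∈? M
  ... | yes p∈M = subst (_∈ A/M) (sym (rep-∈ p∈M)) v∈A/M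
  ... | no  p∉M = subst (_∈ A/M) (sym (rep-∉ p∉M)) (∈A/M⁺ p∈A (rep-∉ p∉M))

  ∈A/M─v⇒∉M : ∀ {x} → x ∈ A/M → x ≢ v → x ∉ M
  ∈A/M─v⇒∉M x∈A/M x≢v x∈M = x≢v (trans (sym (∈A/M⇒fixed x∈A/M)) (rep-∈ x∈M))

  A/M─v⊆A∖M : A/M ─ v ⊆ A ∖ M
  A/M─v⊆A∖M x∈ = ∈-∖⁺ (A/M⊆A (─⊆ x∈)) (∈A/M─v⇒∉M (─⊆ x∈) (∈─⇒≢ x∈))

  A∖M⊆A/M─v : A ∖ M ⊆ A/M ─ v
  A∖M⊆A/M─v x∈ = ∈-─⁺ (∈A/M⁺ (∖⊆ x∈) (rep-∉ (∈∖⇒∉ x∈))) λ { refl → ∈∖⇒∉ x∈ v∈M }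

  contract-walk : ∀ {p q} → Walk D A p q → Walk D/M A/M (rep p) (rep q)
  contract-walk (here p∈A) = here (rep∈A/M p∈A)
  contract-walk (step {w = z} p∈A e r) with rep _ ≟ rep z
  ... | yes same  = subst (λ s → Walk D/M A/M s _) (sym same) (contract-walk r)
  ... | no differ = step (rep∈A/M p∈A) (contracted-edge differ e) (contract-walk r)

  contract-stronglyConnected : StronglyConnectedIn D A → StronglyConnectedIn D/M A/M
  contract-stronglyConnected sc s t s∈A/M t∈A/M =
    subst₂ (Walk D/M A/M) (∈A/M⇒fixed s∈A/M) (∈A/M⇒fixed t∈A/M)
      (contract-walk (sc s t (A/M⊆A s∈A/M) (A/M⊆A t∈A/M)))

  module _ {x} (x∉M : x ∉ M) (M-sc : StronglyConnectedIn D M) where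

    M⊆A─x : M ⊆ A ─ x
    M⊆A─x p∈M = ∈-─⁺ (M⊆A p∈M) λ { refl → x∉M p∈M }

    walk-in-M : ∀ {p q} → p ∈ M → q ∈ M → Walk D (A ─ x) p q
    walk-in-M p∈M q∈M = PathIn-map M⊆A─x (M-sc _ _ p∈M q∈M)

    to-rep : ∀ {y} → y ∈ A ─ x → Walk D (A ─ x) y (rep y)
    to-rep {y} y∈ with y ∈? M
    ... | yes y∈M = subst (Walk D (A ─ x) y) (sym (rep-∈ y∈M)) (walk-in-M y∈M v∈M)
    ... | no  y∉M = subst (Walk D (A ─ x) y) (sym (rep-∉ y∉M)) (here y∈)

    from-rep : ∀ {y} → y ∈ A ─ x → Walk D (A ─ x) (rep y) y
    from-rep {y} y∈ with y ∈? M
    ... | yes y∈M = subst (λ s → Walk D (A ─ x) s y) (sym (rep-∈ y∈M)) (walk-in-M v∈M y∈M)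
    ... | no  y∉M = subst (λ s → Walk D (A ─ x) s y) (sym (rep-∉ y∉M)) (here y∈)

    rep∈A/M─x : ∀ {y} → y ∈ A ─ x → rep y ∈ A/M ─ x
    rep∈A/M─x {y} y∈ with y ∈? M
    ... | yes y∈M = ∈-─⁺ (rep∈A/M (─⊆ y∈)) λ rep-y≡x → x∉M (subst (_∈ M) (trans (sym (rep-∈ y∈M)) rep-y≡x) v∈M)
    ... | no  y∉M = ∈-─⁺ (rep∈A/M (─⊆ y∈)) λ rep-y≡x → ∈─⇒≢ y∈ (trans (sym (rep-∉ y∉M)) rep-y≡x)

    preimage∈A─x : ∀ {p s} → rep p ≡ s → s ∈ A/M ─ x → p ∈ A ─ x
    preimage∈A─x {p} rep-p≡s s∈ with p ∈? M
    ... | yes p∈M = M⊆A─x p∈M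
    ... | no  p∉M = subst (_∈ A ─ x) (trans (sym rep-p≡s) (rep-∉ p∉M)) (∈-─⁺ (A/M⊆A (─⊆ s∈)) (∈─⇒≢ s∈))

    expand-edge : ∀ {s t} → s ∈ A/M ─ x → t ∈ A/M ─ x → Edge D/M s t → Walk D (A ─ x) s t
    expand-edge s∈ t∈ e with contracted-edge⁻ e
    ... | _ , p , q , refl , refl , e′ =
      from-rep p∈ ++ step p∈ e′ (to-rep (preimage∈A─x refl t∈))
      where p∈ = preimage∈A─x refl s∈

    expand-walk : ∀ {s t} → Walk D/M (A/M ─ x) s t → Walk D (A ─ x) s t
    expand-walk (here s∈)     = here (∈-─⁺ (A/M⊆A (─⊆ s∈)) (∈─⇒≢ s∈))
    expand-walk (step s∈ e r) = expand-edge s∈ (PathIn-head r) e ++ expand-walk r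

    expand-stronglyConnected : StronglyConnectedIn D/M (A/M ─ x) → StronglyConnectedIn D (A ─ x)
    expand-stronglyConnected sc y z y∈ z∈ =
      to-rep y∈ ++ expand-walk (sc _ _ (rep∈A/M─x y∈) (rep∈A/M─x z∈)) ++ from-rep z∈

  Absorbs : Fin n → Set
  Absorbs x = (∀ {p} → p ∈ M → Edge D p x → Edge D v x) × (∀ {p} → p ∈ M → Edge D x p → Edge D x v)

  module _ {x} (x∉M : x ∉ M) where

    v≢x : v ≢ x
    v≢x refl = x∉M v∈M

    contracted-out : ∀ {p} → p ∈ M → Edge D p x → Edge D/M v x
    contracted-out p∈M e = subst₂ (Edge D/M) (rep-∈ p∈M) (rep-∉ x∉M)
      (contracted-edge (λ same → v≢x (trans (sym (rep-∈ p∈M)) (trans same (rep-∉ x∉M)))) e)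

    contracted-in : ∀ {p} → p ∈ M → Edge D x p → Edge D/M x v
    contracted-in p∈M e = subst₂ (Edge D/M) (rep-∉ x∉M) (rep-∈ p∈M)
      (contracted-edge (λ same → v≢x (trans (sym (rep-∈ p∈M)) (trans (sym same) (rep-∉ x∉M)))) e)

    links≤contracted : links D v x ≤ links D/M v x
    links≤contracted = +-mono-≤ (b2n-mono (contracted-out v∈M)) (b2n-mono (contracted-in v∈M))

    links≡⇒absorbs : links D v x ≡ links D/M v x → Absorbs x
    links≡⇒absorbs links≡ =
      (λ p∈M e → subst (_≡ true) (sym out≡) (contracted-out p∈M e)) ,
      (λ p∈M e → subst (_≡ true) (sym in≡) (contracted-in p∈M e))
      where
      equal = +-≤-≡ (b2n-mono (contracted-out v∈M)) (b2n-mono (contracted-in v∈M)) links≡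
      out≡ = b2n-injective (proj₁ equal)
      in≡  = b2n-injective (proj₂ equal)

  contract-criticalExcept : StronglyConnectedIn D M → CriticalExcept D A v → CriticalExcept D/M A/M v
  contract-criticalExcept M-sc crit x x∈A/M x≢v sc =
    crit x (A/M⊆A x∈A/M) x≢v (expand-stronglyConnected (∈A/M─v⇒∉M x∈A/M x≢v) M-sc sc)

-- The degree bound when all vertices but one are critical

module DigonContraction {n} (D : Digraph n) (A : VertexSet n) {u v}
                        (v∈A : v ∈ A) (u∈A─v : u ∈ A ─ v) (digon : Digon D v u) where

  u∈A : u ∈ A
  u∈A = ─⊆ u∈A─v

  u≢v : u ≢ v
  u≢v = ∈─⇒≢ u∈A─v

  ⁅u,v⁆⊆A : ⁅ u , v ⁆ ⊆ A
  ⁅u,v⁆⊆A x∈ with ∈⁅u,v⁆⁻ x∈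
  ... | inj₁ refl = u∈A
  ... | inj₂ refl = v∈A

  ⁅u,v⁆-stronglyConnected : StronglyConnectedIn D ⁅ u , v ⁆
  ⁅u,v⁆-stronglyConnected x y x∈ y∈ with ∈⁅u,v⁆⁻ x∈ | ∈⁅u,v⁆⁻ y∈
  ... | inj₁ refl | inj₁ refl = here x∈
  ... | inj₁ refl | inj₂ refl = edge x∈ y∈ (proj₂ digon)
  ... | inj₂ refl | inj₁ refl = edge x∈ y∈ (proj₁ digon)
  ... | inj₂ refl | inj₂ refl = here x∈

  open Contraction D A ⁅ u , v ⁆ ⁅u,v⁆⊆A v∈⁅u,v⁆ public

  A─v─u⊆A/M─v : A ─ v ─ u ⊆ A/M ─ v
  A─v─u⊆A/M─v x∈ = A∖M⊆A/M─v (∈-∖⁺ (─⊆ (─⊆ x∈)) λ x∈⁅u,v⁆ → [ ∈─⇒≢ x∈ , ∈─⇒≢ (─⊆ x∈) ]′ (∈⁅u,v⁆⁻ x∈⁅u,v⁆))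

  A/M─v⊆A─v─u : A/M ─ v ⊆ A ─ v ─ u
  A/M─v⊆A─v─u x∈ = ∈-─⁺ (∈-─⁺ (∖⊆ x∈A∖M) λ { refl → x∉ v∈⁅u,v⁆ }) λ { refl → x∉ u∈⁅u,v⁆ }
    where
    x∈A∖M = A/M─v⊆A∖M x∈
    x∉ : _ ∉ ⁅ u , v ⁆
    x∉ = ∈∖⇒∉ {A = A} x∈A∖M

  sumOver-A─v : ∀ f → sumOver (A ─ v) f ≡ f u + sumOver (A/M ─ v) f
  sumOver-A─v f = trans (sumOver-─ (A ─ v) f u∈A─v) (cong (f u +_) (sumOver-cong A─v─u⊆A/M─v A/M─v⊆A─v─u))

  -- Without such a vertex z, every edge at u is shared by v, and u could be deleted.
  strict-neighbour : StronglyConnectedIn D A → CriticalExcept D A v →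
                     ∃ λ z → z ∈ A/M ─ v × links D v z < links D/M v z
  strict-neighbour sc crit with any? (λ z → z ∈? A/M ─ v ×-dec links D v z <? links D/M v z)
  ... | yes found = found
  ... | no  none  = ⊥-elim (crit u u∈A u≢v (bypass detour sc))
    where
    absorbs : ∀ {x} → x ∈ A ∖ ⁅ u , v ⁆ → Absorbs x
    absorbs x∈ = links≡⇒absorbs (∈∖⇒∉ x∈)
      (≤∧≮⇒≡ (links≤contracted (∈∖⇒∉ x∈)) λ lt → none (_ , A∖M⊆A/M─v x∈ , lt))

    outside : ∀ {x} → x ∈ A ─ u → x ≢ v → x ∈ A ∖ ⁅ u , v ⁆
    outside x∈ x≢v = A/M─v⊆A∖M (A─v─u⊆A/M─v (∈-─⁺ (∈-─⁺ (─⊆ x∈) x≢v) (∈─⇒≢ x∈)))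

    detour : ∀ {x y} → x ∈ A ─ u → y ∈ A ─ u → Edge D x u → Edge D u y → Walk D (A ─ u) x y
    detour {x} {y} x∈ y∈ xu uy with x ≟ v | y ≟ v
    ... | yes refl | yes refl = here x∈
    ... | yes refl | no y≢v   = edge x∈ y∈ (proj₁ (absorbs (outside y∈ y≢v)) u∈⁅u,v⁆ uy)
    ... | no x≢v   | yes refl = edge x∈ y∈ (proj₂ (absorbs (outside x∈ x≢v)) u∈⁅u,v⁆ xu)
    ... | no x≢v   | no y≢v   =
      step x∈ (proj₂ (absorbs (outside x∈ x≢v)) u∈⁅u,v⁆ xu)
        (edge v∈A─u y∈ (proj₁ (absorbs (outside y∈ y≢v)) u∈⁅u,v⁆ uy))
      where
      v∈A─u = ∈-─⁺ v∈A (u≢v ∘ sym)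

  degree-step : StronglyConnectedIn D A → CriticalExcept D A v →
                degreeIn D/M (A/M ─ v) v ≤ size (A/M ─ v) → degreeIn D (A ─ v) v ≤ size (A ─ v)
  degree-step sc crit contracted-bound with strict-neighbour sc crit
  ... | z , z∈ , grows-at-z = begin
    degreeIn D (A ─ v) v                  ≡⟨ sumOver-A─v (links D v) ⟩
    links D v u + degreeIn D (A/M ─ v) v  ≤⟨ +-monoˡ-≤ _ (links≤2 D v u) ⟩
    2 + degreeIn D (A/M ─ v) v            ≤⟨ s≤s (<-≤-trans (sumOver-mono-< grows z∈ grows-at-z) contracted-bound) ⟩
    1 + size (A/M ─ v)                    ≡⟨ sumOver-A─v (λ _ → 1) ⟨
    size (A ─ v)                          ∎
    where
    open ≤-Reasoning
    grows : ∀ {x} → x ∈ A/M ─ v → links D v x ≤ links D/M v x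
    grows x∈ = links≤contracted (∈∖⇒∉ (A/M─v⊆A∖M x∈))

criticalExcept⇒degree≤size : ∀ k {n} (D : Digraph n) (A : VertexSet n) {v} → size (A ─ v) ≡ k → v ∈ A →
                             StronglyConnectedIn D A → CriticalExcept D A v → degreeIn D (A ─ v) v ≤ size (A ─ v)
criticalExcept⇒degree≤size k D A {v} size≡k v∈A sc crit
  with any? (λ u → u ∈? A ─ v ×-dec adj D v u Bool.≟ true ×-dec adj D u v Bool.≟ true)
... | no none = degreeIn≤size-of-digonFree D λ x∈ digon → none (_ , x∈ , digon)
criticalExcept⇒degree≤size zero    D A size≡0 v∈A sc crit | yes (u , u∈A─v , _) =
  ⊥-elim (0≢1+n (trans (sym size≡0) (sumOver-─ (A ─ _) _ u∈A─v)))
criticalExcept⇒degree≤size (suc k) D A size≡k v∈A sc crit | yes (u , u∈A─v , digon) =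
  degree-step sc crit
    (criticalExcept⇒degree≤size k D/M A/M (suc-injective (trans (sym (sumOver-A─v _)) size≡k)) v∈A/M
      (contract-stronglyConnected sc) (contract-criticalExcept ⁅u,v⁆-stronglyConnected crit))
  where open DigonContraction D A v∈A u∈A─v digon

module _ {m : ℕ} where

  next-inner : ∀ (i : Fin (suc m)) → toℕ i < m → toℕ (next i) ≡ suc (toℕ i)
  next-inner i i<m = trans (toℕ-fromℕ< _) (m<n⇒m%n≡m (s≤s i<m))

  next-last : ∀ (i : Fin (suc m)) → toℕ i ≡ m → next i ≡ zero
  next-last i i≡m = toℕ-injective (trans (toℕ-fromℕ< _) (trans (cong (λ t → suc t % suc m) i≡m) (n%n≡0 (suc m))))

  inner-or-last : ∀ (i : Fin (suc m)) → toℕ i < m ⊎ toℕ i ≡ m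
  inner-or-last i = m≤n⇒m<n∨m≡n (s≤s⁻¹ (toℕ<n i))

  inner-next≢zero : ∀ (i : Fin (suc m)) → toℕ i < m → next i ≢ zero
  inner-next≢zero i i<m next-i≡0 = 0≢1+n (trans (cong toℕ (sym next-i≡0)) (next-inner i i<m))

  next-injective : ∀ {i j : Fin (suc m)} → next i ≡ next j → i ≡ j
  next-injective {i} {j} same with inner-or-last i | inner-or-last j
  ... | inj₁ i<m | inj₁ j<m = toℕ-injective (suc-injective
                                 (trans (sym (next-inner i i<m)) (trans (cong toℕ same) (next-inner j j<m))))
  ... | inj₁ i<m | inj₂ j≡m = ⊥-elim (inner-next≢zero i i<m (trans same (next-last j j≡m)))
  ... | inj₂ i≡m | inj₁ j<m = ⊥-elim (inner-next≢zero j j<m (trans (sym same) (next-last i i≡m)))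
  ... | inj₂ i≡m | inj₂ j≡m = toℕ-injective (trans i≡m (sym j≡m))

  next≢ : 1 ≤ m → ∀ (i : Fin (suc m)) → next i ≢ i
  next≢ 1≤m i next-i≡i with inner-or-last i
  ... | inj₁ i<m = 1+n≢n (trans (sym (next-inner i i<m)) (cong toℕ next-i≡i))
  ... | inj₂ i≡m = <⇒≢ 1≤m (trans (sym (cong toℕ (trans (sym next-i≡i) (next-last i i≡m)))) i≡m)

  prev : Fin (suc m) → Fin (suc m)
  prev zero    = fromℕ m
  prev (suc j) = inject₁ j

  next-prev : ∀ (i : Fin (suc m)) → next (prev i) ≡ i
  next-prev zero    = next-last (fromℕ m) (toℕ-fromℕ m)
  next-prev (suc j) = toℕ-injective (trans (next-inner (inject₁ j) (subst (_< m) (sym (toℕ-inject₁ j)) (toℕ<n j)))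
                                           (cong suc (toℕ-inject₁ j)))

  -- Pick any s satisfying P; applying the hypothesis to the predecessor of s yields a second index.
  two-satisfying : 1 ≤ m → (P : Fin (suc m) → Set) → (∀ i → P i ⊎ P (next (next i))) →
                   ∃₂ λ i j → i ≢ j × P i × P j
  two-satisfying 1≤m P P-or = [ around , around ]′ (P-or zero)
    where
    around : ∀ {s} → P s → ∃₂ λ i j → i ≢ j × P i × P j
    around {s} Ps with P-or (prev s)
    ... | inj₁ P-prev =
      s , prev s , (λ s≡prev → next≢ 1≤m (prev s) (trans (next-prev s) s≡prev)) , Ps , P-prev
    ... | inj₂ P-next =
      s , next s , (λ s≡next → next≢ 1≤m s (sym s≡next)) , Ps , subst P (cong next (next-prev s)) P-next

-- Critical digraphs with a chordless cycle

module CriticalWithChordlessCycle {n} (D : Digraph n) (sc : StronglyConnected D)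
                                  (critical : ∀ w → ¬ DeleteStronglyConnected D w)
                                  {m c} (C : ChordlessCycle D m c) where

  open ChordlessCycle C

  V Outside : VertexSet n
  V = image c
  Outside = all ∖ V

  bound : ℕ
  bound = n ∸ suc m + 2

  c∈V : ∀ i → c i ∈ V
  c∈V = f∈image

  ∈V⁻ : ∀ {x} → x ∈ V → ∃ λ j → c j ≡ x
  ∈V⁻ = ∈image⁻ {f = c}

  size-Outside : size Outside ≤ n ∸ suc m
  size-Outside = begin
    size Outside                    ≡⟨ m+n∸m≡n (size V) (size Outside) ⟨
    size V + size Outside ∸ size V  ≡⟨ cong (_∸ size V) (trans (sumOver-complement V _) (size-all n)) ⟩
    n ∸ size V                      ≤⟨ ∸-monoʳ-≤ n (size-image c injective) ⟩
    n ∸ suc m                       ∎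
    where open ≤-Reasoning

  V-stronglyConnected : StronglyConnectedIn D V
  V-stronglyConnected x y x∈V y∈V with ∈V⁻ x∈V | ∈V⁻ y∈V
  ... | i , refl | j , refl = to-start (m ∸ toℕ i) i (m∸n+n≡m (s≤s⁻¹ (toℕ<n i))) ++ from-start _ j refl
    where
    along : ∀ i → Walk D V (c i) (c (next i))
    along i = edge (c∈V i) (c∈V (next i)) (edges i)

    to-start : ∀ d i → d + toℕ i ≡ m → Walk D V (c i) (c zero)
    to-start zero    i i≡m = subst (Walk D V (c i) ∘ c) (next-last i i≡m) (along i)
    to-start (suc d) i d+i≡m = along i ++ to-start d (next i) (begin
      d + toℕ (next i)  ≡⟨ cong (d +_) (next-inner i i<m) ⟩
      d + suc (toℕ i)   ≡⟨ +-suc d (toℕ i) ⟩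
      suc d + toℕ i     ≡⟨ d+i≡m ⟩
      m                 ∎)
      where
      open ≡-Reasoning
      i<m : toℕ i < m
      i<m = subst (toℕ i <_) d+i≡m (s≤s (m≤n+m (toℕ i) d))

    from-start : ∀ d j → toℕ j ≡ d → Walk D V (c zero) (c j)
    from-start _       zero    _      = here (c∈V zero)
    from-start (suc d) (suc j) j≡d+1 =
      from-start d (inject₁ j) (trans (toℕ-inject₁ j) (suc-injective j≡d+1))
        ++ subst (Walk D V (c (inject₁ j)) ∘ c) (next-prev (suc j)) (along (inject₁ j))

  module AtVertex (i : Fin (suc m)) where

    open Contraction D all V (λ _ → member refl) (c∈V i) public

    cycle-degree≤2 : degreeIn D V (c i) ≤ 2
    cycle-degree≤2 = begin
      degreeIn D V (c i)                                                     ≡⟨ sumOver-+ V _ _ ⟩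
      sumOver V (b2n ∘ adj D (c i)) + sumOver V (λ x → b2n (adj D x (c i)))  ≤⟨ +-mono-≤ out≤1 in≤1 ⟩
      2                                                                      ∎
      where
      open ≤-Reasoning
      successor : ∀ {x} → x ∈ V → Edge D (c i) x → x ≡ c (next i)
      successor x∈V e with ∈V⁻ x∈V
      ... | j , refl = cong c (chordless i j e)
      predecessor : ∀ {x} → x ∈ V → Edge D x (c i) → x ≡ c (prev i)
      predecessor x∈V e with ∈V⁻ x∈V
      ... | j , refl = cong c (next-injective (trans (sym (chordless j i e)) (sym (next-prev i))))
      out≤1 = sumOver-b2n≤1 λ x∈V e → successor x∈V (isTrue e)
      in≤1  = sumOver-b2n≤1 λ x∈V e → predecessor x∈V (isTrue e)

    grows : ∀ {x} → x ∈ Outside → links D (c i) x ≤ links D/M (c i) x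
    grows x∈ = links≤contracted (∈∖⇒∉ x∈)

    contracted-bound : degreeIn D/M Outside (c i) ≤ size Outside
    contracted-bound = subst₂ _≤_ Outside-same Outside-same
      (criticalExcept⇒degree≤size _ D/M A/M refl v∈A/M
        (contract-stronglyConnected (stronglyConnectedIn-all sc))
        (contract-criticalExcept V-stronglyConnected
          λ x _ _ sc-x → critical x (deleteStronglyConnected⁺ sc-x)))
      where
      Outside-same : ∀ {f} → sumOver (A/M ─ c i) f ≡ sumOver Outside f
      Outside-same = sumOver-cong A/M─v⊆A∖M A∖M⊆A/M─v

    degree-split : deg D (c i) ≡ degreeIn D V (c i) + degreeIn D Outside (c i)
    degree-split = trans (deg≡sum-links D (c i)) (sym (sumOver-complement V (links D (c i))))

    degree-bound : deg D (c i) ≤ bound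
    degree-bound = begin
      deg D (c i)                                     ≡⟨ degree-split ⟩
      degreeIn D V (c i) + degreeIn D Outside (c i)   ≤⟨ +-mono-≤ cycle-degree≤2 (sumOver-mono grows) ⟩
      2 + degreeIn D/M Outside (c i)                  ≤⟨ +-monoʳ-≤ 2 (≤-trans contracted-bound size-Outside) ⟩
      2 + (n ∸ suc m)                                 ≡⟨ +-comm 2 (n ∸ suc m) ⟩
      bound                                           ∎
      where open ≤-Reasoning

    absorbs-unless-strict : ¬ deg D (c i) < bound → ∀ {x} → x ∈ Outside → Absorbs x
    absorbs-unless-strict not-strict x∈ =
      links≡⇒absorbs (∈∖⇒∉ x∈) (sumOver-mono-≡ grows (≤-trans contracted-bound outside-tight) x∈)
      where
      outside-tight : size Outside ≤ degreeIn D Outside (c i)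
      outside-tight = ≤-trans size-Outside (+-cancelʳ-≤ 2 _ _ (begin
        n ∸ suc m + 2                                   ≤⟨ ≮⇒≥ not-strict ⟩
        deg D (c i)                                     ≡⟨ degree-split ⟩
        degreeIn D V (c i) + degreeIn D Outside (c i)   ≤⟨ +-monoˡ-≤ _ cycle-degree≤2 ⟩
        2 + degreeIn D Outside (c i)                    ≡⟨ +-comm 2 _ ⟩
        degreeIn D Outside (c i) + 2                    ∎))
        where open ≤-Reasoning

  module _ {w₀} (w₀∉C : ∀ i → c i ≢ w₀) where

    w₀∉V : w₀ ∉ V
    w₀∉V w₀∈V with ∈V⁻ w₀∈V
    ... | j , cj≡w₀ = w₀∉C j cj≡w₀

    -- c (i + 1) is bypassed via c i and c (i + 2), which absorb all edges between V and the outside.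
    nonstrict-pair⇒middle-deletable : ∀ i → ¬ deg D (c i) < bound → ¬ deg D (c (next (next i))) < bound →
                                   StronglyConnectedIn D (all ─ c (next i))
    nonstrict-pair⇒middle-deletable i not-strict not-strict₂ = bypass detour (stronglyConnectedIn-all sc)
      where
      w = c (next i)
      absorbs  = AtVertex.absorbs-unless-strict i not-strict
      absorbs₂ = AtVertex.absorbs-unless-strict (next (next i)) not-strict₂

      outside : ∀ {x} → x ∉ V → x ∈ Outside
      outside = ∈-∖⁺ (member refl)

      outside─w : ∀ {x} → x ∉ V → x ∈ all ─ w
      outside─w x∉V = ∈-─⁺ (member refl) λ { refl → x∉V (c∈V (next i)) }

      c-i∈ : c i ∈ all ─ w
      c-i∈ = ∈-─⁺ (member refl) λ same → next≢ length≥2 i (injective (sym same))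

      c-i+2∈ : c (next (next i)) ∈ all ─ w
      c-i+2∈ = ∈-─⁺ (member refl) λ same → next≢ length≥2 (next i) (injective same)

      into-w : ∀ {x} → x ∈ V → Edge D x w → x ≡ c i
      into-w x∈V e with ∈V⁻ x∈V
      ... | j , refl = cong c (next-injective (sym (chordless j (next i) e)))

      out-of-w : ∀ {y} → y ∈ V → Edge D w y → y ≡ c (next (next i))
      out-of-w y∈V e with ∈V⁻ y∈V
      ... | j , refl = cong c (chordless (next i) j e)

      around-outside : Walk D (all ─ w) (c i) (c (next (next i)))
      around-outside with leaving-edge (sc (c zero) w₀) (c∈V zero) w₀∉V
      ... | p , s , p∈V , s∉V , ps with entering-edge (sc s (c zero)) s∉V (c∈V zero)
      ...   | t , q , s⇝t , q∈V , tq =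
        step c-i∈ (proj₁ (absorbs (outside s∉V)) p∈V ps)
          (PathIn-map outside─w s⇝t ++ edge (outside─w t∉V) c-i+2∈ (proj₂ (absorbs₂ (outside t∉V)) q∈V tq))
        where t∉V = PathIn-last s⇝t

      detour : ∀ {x y} → x ∈ all ─ w → y ∈ all ─ w → Edge D x w → Edge D w y → Walk D (all ─ w) x y
      detour {x} {y} x∈ y∈ xw wy with x ∈? V | y ∈? V
      ... | yes x∈V | yes y∈V rewrite into-w x∈V xw | out-of-w y∈V wy = around-outside
      ... | yes x∈V | no  y∉V rewrite into-w x∈V xw =
        edge x∈ y∈ (proj₁ (absorbs (outside y∉V)) (c∈V (next i)) wy)
      ... | no  x∉V | yes y∈V rewrite out-of-w y∈V wy =
        edge x∈ y∈ (proj₂ (absorbs₂ (outside x∉V)) (c∈V (next i)) xw)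
      ... | no  x∉V | no  y∉V =
        step x∈ (proj₂ (absorbs (outside x∉V)) (c∈V (next i)) xw)
          (edge c-i∈ y∈ (proj₁ (absorbs (outside y∉V)) (c∈V (next i)) wy))

    strict-or-strict : ∀ i → deg D (c i) < bound ⊎ deg D (c (next (next i))) < bound
    strict-or-strict i with deg D (c i) <? bound | deg D (c (next (next i))) <? bound
    ... | yes strict | _          = inj₁ strict
    ... | no  _      | yes strict = inj₂ strict
    ... | no  tight  | no  tight₂ =
      ⊥-elim (critical (c (next i)) (deleteStronglyConnected⁺ (nonstrict-pair⇒middle-deletable i tight tight₂)))

lemma2 : ∀ {n : ℕ} (D : Digraph n) (m : ℕ) (c : Fin (suc m) → Fin n)
         → CriticalStronglyConnected D
         → ChordlessCycle D m c
         → (∃[ w ] (∀ i → c i ≢ w))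
         → (∀ i → deg D (c i) ≤ n ∸ suc m + 2)
           × (∃[ i ] ∃[ j ] (i ≢ j × deg D (c i) < n ∸ suc m + 2 × deg D (c j) < n ∸ suc m + 2))
lemma2 D m c (sc , critical) C (w₀ , w₀∉C) =
  AtVertex.degree-bound , two-satisfying length≥2 _ (strict-or-strict w₀∉C)
  where
  open CriticalWithChordlessCycle D sc critical C
  open ChordlessCycle C using (length≥2)
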